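{- Let $n,m,d$ be positive integers with $n>(d+2)(d+3)m$. Let $G$ be a graph and $U\subseteq V(G)$ with $|U|\ge (d+3)^2m$, such that $\overline{G[U]}$ contains no copy of $K_{m,m}$ and $|N_G(S)\cup S|\ge n$ for every $S\subseteq U$ with $|S|\ge m$. Then there is a set $B\subseteq U$ with $|B|<m$ such that $G[U\setminus B]$ is a $(d,(d+2)m,n)$-expander in $G\setminus B$.
   Context: $N_G(S)$ is the set of vertices adjacent to some vertex of $S$; $\overline{G}$ denotes the complement. For an induced subgraph $H$ of a graph $G$, $H$ is a $(d,m,n)$-expander in $G$ if (i) $|N_H(S)|\ge d|S|$ for all $S\subseteq V(H)$ with $|S|<m$, and (ii) $|N_G(S)\cup S|\ge n$ for all $S\subseteq V(H)$ with $|S|\ge m$. -}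

module Defs where

open import Data.Nat using (ℕ; _≤_; _<_; _*_)
open import Data.Bool using (Bool; true; false; _∧_)
open import Data.Fin using (Fin)
open import Data.Fin.Subset using (Subset; _⊆_; _∪_; ∣_∣; Empty)
open import Data.Vec using (tabulate; lookup)
open import Data.List using (allFin)
open import Data.Bool.ListAction using (any)
open import Data.Empty using (⊥)
open import Data.Product using (Σ; _×_)
open import Relation.Binary.PropositionalEquality using (_≡_)

record Graph (N : ℕ) : Set where
  field
    adj    : Fin N → Fin N → Bool
    sym    : ∀ u v → adj u v ≡ adj v u
    irrefl : ∀ v → adj v v ≡ false
open Graph public

-- Neighbourhood of S in the induced subgraph G[A]:
-- N_{G[A]}(S) = { v ∈ A : v adjacent (in G) to some u ∈ S }.
-- (With A = ⊤ this is N_G(S).)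
nbr : ∀ {N} → Graph N → Subset N → Subset N → Subset N
nbr G A S = tabulate λ v →
  lookup A v ∧ any (λ u → lookup S u ∧ adj G u v) (allFin _)

ComplContainsKmm : ∀ {N} → Graph N → Subset N → ℕ → Set
ComplContainsKmm {N} G U m =
  Σ (Subset N) λ X → Σ (Subset N) λ Y →
    X ⊆ U × Y ⊆ U × ∣ X ∣ ≡ m × ∣ Y ∣ ≡ m
    × (∀ x y → lookup X x ≡ true → lookup Y y ≡ true → x ≡ y → ⊥)
    × (∀ x y → lookup X x ≡ true → lookup Y y ≡ true → adj G x y ≡ false)

-- H = G[W] is a (d,m,n)-expander in the host graph G[A] (W ⊆ A):
-- (i)  |N_H(S)| ≥ d|S| for all S ⊆ W with |S| < m;
-- (ii) |N_{G[A]}(S) ∪ S| ≥ n for all S ⊆ W with |S| ≥ m.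
IsExpander : ∀ {N} → Graph N → (A W : Subset N) → (d m n : ℕ) → Set
IsExpander G A W d m n =
  (∀ S → S ⊆ W → ∣ S ∣ < m → d * ∣ S ∣ ≤ ∣ nbr G W S ∣)
  × (∀ S → S ⊆ W → m ≤ ∣ S ∣ → n ≤ ∣ nbr G A S ∪ S ∣)

-- Let ∂B be the set of neighbours of B in U outside B.  Grow B ⊆ U greedily, absorbing
-- any S ⊆ U ─ B with |S| < (d+2)m and fewer than d|S| neighbours in G[U ─ B]; this keeps
-- |∂B| ≤ d|B| and |B| ≤ (d+3)m.  Then U still has m vertices outside B ∪ ∂B, none
-- adjacent to B, so K_{m,m}-freeness of the complement forces |B| < m; hence the process
-- stops, and then (i) holds.  For (ii), removing the fewer than dm vertices of ∂B from a
-- large S ⊆ U ─ B leaves at least m vertices whose closed neighbourhood in G avoids B.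
module Submission where

open import Defs hiding (sym)
open import Data.Nat using (ℕ; zero; suc; _≤_; _<_; _>_; _*_; _+_; _^_; z≤n; s≤s; _≤?_; _<?_)
open import Data.Nat.Properties
open import Data.Nat.Tactic.RingSolver using (solve-∀)
open import Data.Bool using (true; false; _∧_; T)
open import Data.Bool.Properties using (T-≡)
open import Data.Fin using (Fin)
open import Data.Fin.Subset using (Subset; _⊆_; _∪_; _─_; ∁; ⊤; ⊥; ∣_∣; _∈_; _∉_)
open import Data.Fin.Subset.Properties
open import Data.Vec using ([]; _∷_; lookup; here; there)
open import Data.Vec.Properties using (lookup∘tabulate; []=⇒lookup; lookup⇒[]=)
open import Data.List using (allFin)
open import Data.List.Membership.Propositional using (lose)
open import Data.List.Membership.Propositional.Properties using (∈-allFin)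
open import Data.List.Relation.Unary.Any using (satisfied)
open import Data.List.Relation.Unary.Any.Properties using (any⁺; any⁻)
open import Data.Product using (Σ; _×_; _,_)
open import Data.Sum using (inj₁; inj₂)
open import Data.Empty using (⊥-elim)
open import Relation.Nullary using (¬_; Dec; yes; no)
open import Relation.Nullary.Decidable using (_×-dec_)
open import Relation.Binary.PropositionalEquality
open import Function using (Equivalence)
open Equivalence using (to; from)

private
  variable
    N : ℕ

∣p∪q∣≤∣p∣+∣q∣ : (p q : Subset N) → ∣ p ∪ q ∣ ≤ ∣ p ∣ + ∣ q ∣
∣p∪q∣≤∣p∣+∣q∣ []          []          = z≤n
∣p∪q∣≤∣p∣+∣q∣ (true ∷ p)  (true ∷ q)  = s≤s (≤-trans (∣p∪q∣≤∣p∣+∣q∣ p q) (≤-trans (n≤1+n _) (≤-reflexive (sym (+-suc _ _)))))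
∣p∪q∣≤∣p∣+∣q∣ (true ∷ p)  (false ∷ q) = s≤s (∣p∪q∣≤∣p∣+∣q∣ p q)
∣p∪q∣≤∣p∣+∣q∣ (false ∷ p) (true ∷ q)  = ≤-trans (s≤s (∣p∪q∣≤∣p∣+∣q∣ p q)) (≤-reflexive (sym (+-suc _ _)))
∣p∪q∣≤∣p∣+∣q∣ (false ∷ p) (false ∷ q) = ∣p∪q∣≤∣p∣+∣q∣ p q

disjoint⇒∣p∣+∣q∣≤∣p∪q∣ : (p q : Subset N) → (∀ {x} → x ∈ p → x ∉ q) → ∣ p ∣ + ∣ q ∣ ≤ ∣ p ∪ q ∣
disjoint⇒∣p∣+∣q∣≤∣p∪q∣ []          []          _   = z≤n
disjoint⇒∣p∣+∣q∣≤∣p∪q∣ (true ∷ p)  (true ∷ q)  p#q = ⊥-elim (p#q here here)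
disjoint⇒∣p∣+∣q∣≤∣p∪q∣ (true ∷ p)  (false ∷ q) p#q = s≤s (disjoint⇒∣p∣+∣q∣≤∣p∪q∣ p q (λ x∈p x∈q → p#q (there x∈p) (there x∈q)))
disjoint⇒∣p∣+∣q∣≤∣p∪q∣ (false ∷ p) (true ∷ q)  p#q = ≤-trans (≤-reflexive (+-suc _ _)) (s≤s (disjoint⇒∣p∣+∣q∣≤∣p∪q∣ p q (λ x∈p x∈q → p#q (there x∈p) (there x∈q))))
disjoint⇒∣p∣+∣q∣≤∣p∪q∣ (false ∷ p) (false ∷ q) p#q = disjoint⇒∣p∣+∣q∣≤∣p∪q∣ p q (λ x∈p x∈q → p#q (there x∈p) (there x∈q))

x∈p─q⇒x∉q : (p q : Subset N) {x : Fin N} → x ∈ p ─ q → x ∉ q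
x∈p─q⇒x∉q (_ ∷ p) (_ ∷ q) (there x∈p─q) (there x∈q) = x∈p─q⇒x∉q p q x∈p─q x∈q

p⊆p─q∪q : (p q : Subset N) → p ⊆ (p ─ q) ∪ q
p⊆p─q∪q p q {x} x∈p with x ∈? q
... | yes x∈q = q⊆p∪q (p ─ q) q x∈q
... | no  x∉q = p⊆p∪q q (x∈p∧x∉q⇒x∈p─q x∈p x∉q)

∪-least : {p q r : Subset N} → p ⊆ r → q ⊆ r → p ∪ q ⊆ r
∪-least {p = p} {q} p⊆r q⊆r x∈p∪q with x∈p∪q⁻ p q x∈p∪q
... | inj₁ x∈p = p⊆r x∈p
... | inj₂ x∈q = q⊆r x∈q

∃-⊆-of-size : (p : Subset N) (k : ℕ) → k ≤ ∣ p ∣ → Σ (Subset N) λ q → q ⊆ p × ∣ q ∣ ≡ k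
∃-⊆-of-size {N} p          zero    _        = ⊥ , (λ x∈⊥ → ⊥-elim (∉⊥ x∈⊥)) , ∣⊥∣≡0 N
∃-⊆-of-size (true ∷ p)  (suc k) (s≤s k≤) with ∃-⊆-of-size p k k≤
... | q , q⊆p , ∣q∣≡k = true ∷ q , s⊆s q⊆p , cong suc ∣q∣≡k
∃-⊆-of-size (false ∷ p) (suc k) k≤       with ∃-⊆-of-size p (suc k) k≤
... | q , q⊆p , ∣q∣≡k = false ∷ q , s⊆s q⊆p , ∣q∣≡k

∧-true⁻ : ∀ {a b} → a ∧ b ≡ true → a ≡ true × b ≡ true
∧-true⁻ {true} {true} refl = refl , refl

∈-nbr⁻ : (G : Graph N) (A S : Subset N) {v : Fin N} → v ∈ nbr G A S
  → v ∈ A × Σ (Fin N) λ u → u ∈ S × adj G u v ≡ true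
∈-nbr⁻ {N} G A S {v} v∈ with ∧-true⁻ (trans (sym (lookup∘tabulate _ v)) ([]=⇒lookup v∈))
... | v∈A , some-u with satisfied (any⁻ _ (allFin N) (from T-≡ some-u))
... | u , u-ok with ∧-true⁻ (to T-≡ u-ok)
... | u∈S , uv = lookup⇒[]= v A v∈A , u , lookup⇒[]= u S u∈S , uv

∈-nbr⁺ : (G : Graph N) (A S : Subset N) {u v : Fin N} → v ∈ A → u ∈ S → adj G u v ≡ true → v ∈ nbr G A S
∈-nbr⁺ G A S {u} {v} v∈A u∈S uv = lookup⇒[]= v _ (trans (lookup∘tabulate _ v) lookup-v)
  where
  u-ok : T (lookup S u ∧ adj G u v)
  u-ok = from T-≡ (cong₂ _∧_ ([]=⇒lookup u∈S) uv)
  lookup-v : lookup A v ∧ _ ≡ true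
  lookup-v = cong₂ _∧_ ([]=⇒lookup v∈A) (to T-≡ (any⁺ _ (lose (∈-allFin u) u-ok)))

boundary : Graph N → Subset N → Subset N → Subset N
boundary G U C = nbr G U C ─ C

boundary-∪ : (G : Graph N) (U B S : Subset N) → boundary G U (B ∪ S) ⊆ boundary G U B ∪ nbr G (U ─ B) S
boundary-∪ G U B S {v} v∈∂ with ∈-nbr⁻ G U (B ∪ S) (p─q⊆p _ _ v∈∂)
... | v∈U , u , u∈B∪S , uv with x∈p∪q⁻ B S u∈B∪S
... | inj₁ u∈B = p⊆p∪q _ (x∈p∧x∉q⇒x∈p─q (∈-nbr⁺ G U B v∈U u∈B uv) v∉B)
  where v∉B = λ v∈B → x∈p─q⇒x∉q _ _ v∈∂ (p⊆p∪q S v∈B)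
... | inj₂ u∈S = q⊆p∪q (boundary G U B) _ (∈-nbr⁺ G (U ─ B) S (x∈p∧x∉q⇒x∈p─q v∈U v∉B) u∈S uv)
  where v∉B = λ v∈B → x∈p─q⇒x∉q _ _ v∈∂ (p⊆p∪q S v∈B)

non-adjacent-outside-closure : (G : Graph N) (U C : Subset N) {x y : Fin N}
  → x ∈ C → y ∈ U ─ (C ∪ boundary G U C) → adj G x y ≡ false
non-adjacent-outside-closure G U C {x} {y} x∈C y∈R with adj G x y in xy
... | false = refl
... | true  = ⊥-elim (x∈p─q⇒x∉q U _ y∈R (q⊆p∪q C _ (x∈p∧x∉q⇒x∈p─q y∈N y∉C)))
  where
  y∈N = ∈-nbr⁺ G U C (p─q⊆p U _ y∈R) x∈C xy
  y∉C = λ y∈C → x∈p─q⇒x∉q U _ y∈R (p⊆p∪q _ y∈C)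

-- C and U ─ (C ∪ ∂C) span a complete bipartite graph in the complement.
sparse-boundary⇒ComplContainsKmm : (G : Graph N) (U C : Subset N) (m : ℕ) → C ⊆ U
  → m ≤ ∣ C ∣ → m + (∣ C ∣ + ∣ boundary G U C ∣) ≤ ∣ U ∣ → ComplContainsKmm G U m
sparse-boundary⇒ComplContainsKmm G U C m C⊆U m≤∣C∣ room
  with ∃-⊆-of-size C m m≤∣C∣ | ∃-⊆-of-size R m m≤∣R∣
  where
  R = U ─ (C ∪ boundary G U C)
  m≤∣R∣ : m ≤ ∣ R ∣
  m≤∣R∣ = +-cancelʳ-≤ (∣ C ∣ + ∣ boundary G U C ∣) m ∣ R ∣ (≤-trans room (begin
    ∣ U ∣                                          ≤⟨ p⊆q⇒∣p∣≤∣q∣ (p⊆p─q∪q U (C ∪ boundary G U C)) ⟩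
    ∣ R ∪ (C ∪ boundary G U C) ∣                   ≤⟨ ∣p∪q∣≤∣p∣+∣q∣ R _ ⟩
    ∣ R ∣ + ∣ C ∪ boundary G U C ∣                 ≤⟨ +-monoʳ-≤ ∣ R ∣ (∣p∪q∣≤∣p∣+∣q∣ C _) ⟩
    ∣ R ∣ + (∣ C ∣ + ∣ boundary G U C ∣)           ∎))
    where open ≤-Reasoning
... | X , X⊆C , ∣X∣≡m | Y , Y⊆R , ∣Y∣≡m =
  X , Y , ⊆-trans X⊆C C⊆U , ⊆-trans Y⊆R (p─q⊆p U _) , ∣X∣≡m , ∣Y∣≡m , distinct , non-adjacent
  where
  distinct : ∀ x y → lookup X x ≡ true → lookup Y y ≡ true → x ≡ y → Data.Empty.⊥
  distinct x .x x∈X x∈Y refl =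
    x∈p─q⇒x∉q U _ (Y⊆R (lookup⇒[]= x Y x∈Y)) (p⊆p∪q _ (X⊆C (lookup⇒[]= x X x∈X)))
  non-adjacent : ∀ x y → lookup X x ≡ true → lookup Y y ≡ true → adj G x y ≡ false
  non-adjacent x y x∈X y∈Y =
    non-adjacent-outside-closure G U C (X⊆C (lookup⇒[]= x X x∈X)) (Y⊆R (lookup⇒[]= y Y y∈Y))

-- Removing ∂B from S leaves a set whose closed neighbourhood in G misses B.
expansion-avoiding : (G : Graph N) (U B : Subset N) (m n : ℕ)
  → (∀ S → S ⊆ U → m ≤ ∣ S ∣ → n ≤ ∣ nbr G ⊤ S ∪ S ∣)
  → ∀ S → S ⊆ U ─ B → m + ∣ boundary G U B ∣ ≤ ∣ S ∣ → n ≤ ∣ nbr G (∁ B) S ∪ S ∣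
expansion-avoiding G U B m n expands S S⊆U─B large =
  ≤-trans (expands core (⊆-trans (p─q⊆p S _) (⊆-trans S⊆U─B (p─q⊆p U B))) m≤∣core∣) (p⊆q⇒∣p∣≤∣q∣ closure-core⊆)
  where
  core = S ─ nbr G U B
  S⊆core∪∂B : S ⊆ core ∪ boundary G U B
  S⊆core∪∂B {x} x∈S with x∈p∪q⁻ core _ (p⊆p─q∪q S (nbr G U B) x∈S)
  ... | inj₁ x∈core = p⊆p∪q _ x∈core
  ... | inj₂ x∈N = q⊆p∪q core _ (x∈p∧x∉q⇒x∈p─q x∈N (x∈p─q⇒x∉q U B (S⊆U─B x∈S)))
  m≤∣core∣ : m ≤ ∣ core ∣
  m≤∣core∣ = +-cancelʳ-≤ _ m ∣ core ∣ (≤-trans large (≤-trans (p⊆q⇒∣p∣≤∣q∣ S⊆core∪∂B) (∣p∪q∣≤∣p∣+∣q∣ core _)))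
  closure-core⊆ : nbr G ⊤ core ∪ core ⊆ nbr G (∁ B) S ∪ S
  closure-core⊆ {x} x∈ with x∈p∪q⁻ (nbr G ⊤ core) core x∈
  ... | inj₂ x∈core = q⊆p∪q _ S (p─q⊆p S _ x∈core)
  ... | inj₁ x∈N with ∈-nbr⁻ G ⊤ core x∈N
  ... | _ , u , u∈core , ux = p⊆p∪q S (∈-nbr⁺ G (∁ B) S (x∉p⇒x∈∁p x∉B) (p─q⊆p S _ u∈core) ux)
    where
    x∉B : x ∉ B
    x∉B x∈B = x∈p─q⇒x∉q S _ u∈core
      (∈-nbr⁺ G U B (p─q⊆p U B (S⊆U─B (p─q⊆p S _ u∈core))) x∈B (trans (Graph.sym G x u) ux))

module Greedy (G : Graph N) (U : Subset N) (d m : ℕ)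
  (U-large : (d + 3) ^ 2 * m ≤ ∣ U ∣) (K-free : ¬ ComplContainsKmm G U m) where

  Sparse : Subset N → Set
  Sparse B = B ⊆ U × ∣ B ∣ < m × ∣ boundary G U B ∣ ≤ d * ∣ B ∣

  NonExpanding : Subset N → Subset N → Set
  NonExpanding B S = S ⊆ U ─ B × ∣ S ∣ < (d + 2) * m × ∣ nbr G (U ─ B) S ∣ < d * ∣ S ∣

  nonExpanding? : ∀ B → Dec (Σ (Subset N) (NonExpanding B))
  nonExpanding? B = anySubset? λ S →
    S ⊆? U ─ B ×-dec ∣ S ∣ <? (d + 2) * m ×-dec ∣ nbr G (U ─ B) S ∣ <? d * ∣ S ∣

  closure-room : ∀ k → k ≤ (d + 3) * m → m + (k + d * k) ≤ (d + 3) ^ 2 * m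
  closure-room k k≤ = begin
    m + (k + d * k)                                  ≤⟨ +-monoʳ-≤ m (*-monoʳ-≤ (1 + d) k≤) ⟩
    m + (1 + d) * ((d + 3) * m)                      ≤⟨ m≤m+n _ ((2 * d + 5) * m) ⟩
    m + (1 + d) * ((d + 3) * m) + (2 * d + 5) * m    ≡⟨ square-expansion d m ⟨
    (d + 3) ^ 2 * m                                  ∎
    where
    open ≤-Reasoning
    square-expansion : ∀ d m → (d + 3) * ((d + 3) * 1) * m ≡ m + (1 + d) * ((d + 3) * m) + (2 * d + 5) * m
    square-expansion = solve-∀

  sparse-small : ∀ C → C ⊆ U → ∣ boundary G U C ∣ ≤ d * ∣ C ∣ → ∣ C ∣ ≤ (d + 3) * m → ∣ C ∣ < m
  sparse-small C C⊆U ∂C≤ ∣C∣≤ with m ≤? ∣ C ∣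
  ... | no  m≰∣C∣ = ≰⇒> m≰∣C∣
  ... | yes m≤∣C∣ = ⊥-elim (K-free (sparse-boundary⇒ComplContainsKmm G U C m C⊆U m≤∣C∣
          (≤-trans (+-monoʳ-≤ m (+-monoʳ-≤ ∣ C ∣ ∂C≤)) (≤-trans (closure-room ∣ C ∣ ∣C∣≤) U-large))))

  absorb : ∀ B S → Sparse B → NonExpanding B S → Sparse (B ∪ S) × ∣ B ∣ < ∣ B ∪ S ∣
  absorb B S (B⊆U , ∣B∣<m , ∂B≤) (S⊆U─B , ∣S∣< , few-nbrs) =
    (B∪S⊆U , sparse-small (B ∪ S) B∪S⊆U ∂B∪S≤ ∣B∪S∣≤ , ∂B∪S≤) , grows
    where
    B∪S⊆U = ∪-least B⊆U (⊆-trans S⊆U─B (p─q⊆p U B))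
    disjoint : ∀ {x} → x ∈ B → x ∉ S
    disjoint x∈B x∈S = x∈p─q⇒x∉q U B (S⊆U─B x∈S) x∈B
    ∣B∣+∣S∣≤ = disjoint⇒∣p∣+∣q∣≤∣p∪q∣ B S disjoint
    S-nonempty : 1 ≤ ∣ S ∣
    S-nonempty = n≢0⇒n>0 λ ∣S∣≡0 → n≮0 (subst (∣ nbr G (U ─ B) S ∣ <_) (trans (cong (d *_) ∣S∣≡0) (*-zeroʳ d)) few-nbrs)
    grows : ∣ B ∣ < ∣ B ∪ S ∣
    grows = ≤-trans (≤-trans (≤-reflexive (+-comm 1 ∣ B ∣)) (+-monoʳ-≤ ∣ B ∣ S-nonempty)) ∣B∣+∣S∣≤
    ∂B∪S≤ : ∣ boundary G U (B ∪ S) ∣ ≤ d * ∣ B ∪ S ∣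
    ∂B∪S≤ = begin
      ∣ boundary G U (B ∪ S) ∣                       ≤⟨ p⊆q⇒∣p∣≤∣q∣ (boundary-∪ G U B S) ⟩
      ∣ boundary G U B ∪ nbr G (U ─ B) S ∣           ≤⟨ ∣p∪q∣≤∣p∣+∣q∣ (boundary G U B) _ ⟩
      ∣ boundary G U B ∣ + ∣ nbr G (U ─ B) S ∣       ≤⟨ +-mono-≤ ∂B≤ (<⇒≤ few-nbrs) ⟩
      d * ∣ B ∣ + d * ∣ S ∣                          ≡⟨ *-distribˡ-+ d ∣ B ∣ ∣ S ∣ ⟨
      d * (∣ B ∣ + ∣ S ∣)                            ≤⟨ *-monoʳ-≤ d ∣B∣+∣S∣≤ ⟩
      d * ∣ B ∪ S ∣                                  ∎
      where open ≤-Reasoning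
    ∣B∪S∣≤ : ∣ B ∪ S ∣ ≤ (d + 3) * m
    ∣B∪S∣≤ = begin
      ∣ B ∪ S ∣          ≤⟨ ∣p∪q∣≤∣p∣+∣q∣ B S ⟩
      ∣ B ∣ + ∣ S ∣      ≤⟨ +-mono-≤ (<⇒≤ ∣B∣<m) (<⇒≤ ∣S∣<) ⟩
      m + (d + 2) * m    ≡⟨ split d m ⟨
      (d + 3) * m        ∎
      where
      open ≤-Reasoning
      split : ∀ d m → (d + 3) * m ≡ m + (d + 2) * m
      split = solve-∀

  -- The fuel f bounds the number of further absorptions, since each one enlarges B.
  maximal-sparse-from : ∀ f B → Sparse B → m ≤ ∣ B ∣ + f
    → Σ (Subset N) λ B′ → Sparse B′ × ¬ Σ (Subset N) (NonExpanding B′)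
  maximal-sparse-from zero    B (_ , ∣B∣<m , _) m≤ = ⊥-elim (<⇒≱ ∣B∣<m (subst (m ≤_) (+-identityʳ _) m≤))
  maximal-sparse-from (suc f) B sparse m≤ with nonExpanding? B
  ... | no  none        = B , sparse , none
  ... | yes (S , S-bad) with absorb B S sparse S-bad
  ... | sparse′ , grows =
    maximal-sparse-from f (B ∪ S) sparse′ (≤-trans m≤ (≤-trans (≤-reflexive (+-suc ∣ B ∣ f)) (+-monoˡ-≤ f grows)))

  ⊥-sparse : 1 ≤ m → Sparse ⊥
  ⊥-sparse 1≤m = (λ x∈⊥ → ⊥-elim (∉⊥ x∈⊥)) , subst (_< m) (sym (∣⊥∣≡0 N)) 1≤m , ∂⊥≤
    where
    ∂⊥⊆⊥ : boundary G U ⊥ ⊆ ⊥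
    ∂⊥⊆⊥ v∈∂ with ∈-nbr⁻ G U ⊥ (p─q⊆p _ _ v∈∂)
    ... | _ , _ , u∈⊥ , _ = ⊥-elim (∉⊥ u∈⊥)
    ∂⊥≤ : ∣ boundary G U ⊥ ∣ ≤ d * ∣ ⊥ {N} ∣
    ∂⊥≤ = ≤-trans (p⊆q⇒∣p∣≤∣q∣ ∂⊥⊆⊥) (≤-trans (≤-reflexive (∣⊥∣≡0 N)) z≤n)

  maximal-sparse : 1 ≤ m → Σ (Subset N) λ B → Sparse B × ¬ Σ (Subset N) (NonExpanding B)
  maximal-sparse 1≤m = maximal-sparse-from m ⊥ (⊥-sparse 1≤m) (m≤n+m m _)

  maximal⇒expanding : ∀ B → ¬ Σ (Subset N) (NonExpanding B)
    → ∀ S → S ⊆ U ─ B → ∣ S ∣ < (d + 2) * m → d * ∣ S ∣ ≤ ∣ nbr G (U ─ B) S ∣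
  maximal⇒expanding B maximal S S⊆U─B ∣S∣< with d * ∣ S ∣ ≤? ∣ nbr G (U ─ B) S ∣
  ... | yes expands = expands
  ... | no  fails   = ⊥-elim (maximal (S , S⊆U─B , ∣S∣< , ≰⇒> fails))

  sparse⇒boundary-room : ∀ B → Sparse B → m + ∣ boundary G U B ∣ ≤ (d + 2) * m
  sparse⇒boundary-room B (_ , ∣B∣<m , ∂B≤) = begin
    m + ∣ boundary G U B ∣    ≤⟨ +-monoʳ-≤ m (≤-trans ∂B≤ (*-monoʳ-≤ d (<⇒≤ ∣B∣<m))) ⟩
    m + d * m                 ≤⟨ m≤n+m _ m ⟩
    m + (m + d * m)           ≡⟨ split d m ⟨
    (d + 2) * m               ∎
    where
    open ≤-Reasoning
    split : ∀ d m → (d + 2) * m ≡ m + (m + d * m)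
    split = solve-∀

lemma3p2 : (n m d : ℕ) → 1 ≤ n → 1 ≤ m → 1 ≤ d
    → n > (d + 2) * (d + 3) * m
    → {N : ℕ} (G : Graph N) (U : Subset N)
    → (d + 3) ^ 2 * m ≤ ∣ U ∣
    → ¬ ComplContainsKmm G U m
    → (∀ S → S ⊆ U → m ≤ ∣ S ∣ → n ≤ ∣ nbr G ⊤ S ∪ S ∣)
    → Σ (Subset N) λ B → B ⊆ U × ∣ B ∣ < m
    × IsExpander G (∁ B) (U ─ B) d ((d + 2) * m) n
lemma3p2 n m d _ 1≤m _ _ G U U-large K-free expands
  with Greedy.maximal-sparse G U d m U-large K-free 1≤m
... | B , sparse@(B⊆U , ∣B∣<m , _) , maximal =
  B , B⊆U , ∣B∣<m , maximal⇒expanding B maximal , λ S S⊆U─B large →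
    expansion-avoiding G U B m n expands S S⊆U─B (≤-trans (sparse⇒boundary-room B sparse) large)
  where open Greedy G U d m U-large K-free
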